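{- Let $G$ be a connected graph (no loops, no multiple edges), $b\in V_G$, $\ell\in\mathbb{Z}_{\ge0}$, and $\mathbf{q}$ a $G$-path starting at $b$. Let $\operatorname{IP}^{\preceq\mathbf{q}}_{G,b,\ell}=\{\langle\mathbf{p},a\rangle\in\operatorname{IP}_{G,b,\ell}:\mathbf{p}\preceq^{\mathrm{pre}}\mathbf{q}\}$ with the order $\preceq^{\mathrm{IP}}$. Then the map $\langle\mathbf{p},a\rangle\mapsto g^{\mathbf{q}}(\tau(\langle\mathbf{p},a\rangle))$ is an isomorphism of posets from $\operatorname{IP}^{\preceq\mathbf{q}}_{G,b,\ell}$ onto the poset $J(\operatorname{Tab}^{\mathbf{q},\infty}_{G,b,\ell})$ of join-irreducible elements of $\operatorname{Tab}^{\mathbf{q},\infty}_{G,b,\ell}$ (with the induced order $\preceq^\infty$).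
   Context: A $G$-path $\mathbf{p}$ has length $\#\mathbf{p}$, edges $\mathbf{p}_i=\{p_{i-1},p_i\}\in E_G$ and vertices $p_0,\dots,p_{\#\mathbf{p}}$; $\mathbf{p}\preceq^{\mathrm{pre}}\mathbf{q}$ means $\mathbf{p}$ is a prefix of $\mathbf{q}$; cycle-free means distinct vertices. For $\#\mathbf{p}>0$ let $\mathbf{p}=\mathbf{p}^{(1)}\cdots\mathbf{p}^{(n_{\mathbf{p}})}$ be the unique factorization into positive-length paths with each $\mathbf{p}^{(t)}$ the longest cycle-free suffix of $\mathbf{p}^{(1)}\cdots\mathbf{p}^{(t)}$, and $d_{\mathbf{p}}(r)$ the index of the block containing the $r$-th edge. $\operatorname{IP}_{G,b,\ell}$: pairs $\langle\mathbf{p},a\rangle$, $\mathbf{p}$ a $G$-path from $b$, $\#\mathbf{p}>0$, $a\in\mathbb{Z}$ with $0\le a\le\ell+1-\#\mathbf{p}-n_{\mathbf{p}}$; $\langle\mathbf{p},a\rangle\preceq^{\mathrm{IP}}\langle\mathbf{r},c\rangle$ iff $\mathbf{p}\preceq^{\mathrm{pre}}\mathbf{r}$ and $n_{\mathbf{p}}+a\ge d_{\mathbf{r}}(\#\mathbf{p})+c$. A $(G,b,\ell)$-tableau is $(\mathbf{p},L)$, $\mathbf{p}$ a $G$-path from $b$, $L:[1,\#\mathbf{p}]\to\mathbb{Z}_{\ge0}$ with (i) $L$ weakly increasing, (ii) $i<j$, $p_{i-1}=p_j$ imply $L(i)<L(j)$, (iii) $L(\#\mathbf{p})+\#\mathbf{p}\le\ell$.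 $\tau(\langle\mathbf{p},a\rangle)=(\mathbf{p},L_{\langle\mathbf{p},a\rangle})$, $L_{\langle\mathbf{p},a\rangle}(r)=d_{\mathbf{p}}(r)+a-1$. An extended $\mathbf{q}$-tableau is a weakly increasing $U:[1,\#\mathbf{q}]\to\mathbb{Z}_{\ge0}\cup\{\infty\}$ such that whenever $U(m)<\infty$, $((\mathbf{q}_1,\dots,\mathbf{q}_m),U|_{[1,m]})$ is a $(G,b,\ell)$-tableau; $\operatorname{Tab}^{\mathbf{q},\infty}_{G,b,\ell}$ is their set, a lattice under $U\preceq^\infty U'$ iff $U(i)\ge U'(i)$ for all $i$ (join = pointwise min, meet = pointwise max). $g^{\mathbf{q}}$ sends a tableau $(\mathbf{p},L)$ with $\mathbf{p}\preceq^{\mathrm{pre}}\mathbf{q}$ to the function equal to $L$ on $[1,\#\mathbf{p}]$ and $\infty$ on $[\#\mathbf{p}+1,\#\mathbf{q}]$. Join-irreducible: not the least element, and $u=v\vee w$ implies $u\in\{v,w\}$. -}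

module Defs where

open import Data.Nat using (ℕ; zero; suc; _+_; _∸_; _≤_; _<_; _≥_; _≤ᵇ_; _⊓_)
open import Data.Fin using (Fin)
open import Data.Fin.Properties using (_≟_)
open import Data.List using (List; []; _∷_; _++_; length; take; drop; reverse)
open import Data.Product using (Σ; _×_; _,_; ∃)
open import Data.Sum using (_⊎_)
open import Data.Unit using (⊤)
open import Data.Empty using (⊥)
open import Relation.Nullary using (¬_; yes; no)
open import Data.Bool using (Bool; true; false)
open import Relation.Binary.PropositionalEquality using (_≡_)

record Graph : Set₁ where
  field
    n      : ℕ
    Adj    : Fin n → Fin n → Set
    sym    : ∀ {u v} → Adj u v → Adj v u
    irrefl : ∀ {u} → ¬ Adj u u

module _ (G : Graph) where
  open Graph G

  -- A G-path from b is given by the list of its vertices p₁ … p_k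
  -- (p₀ = b is the start).  Its length #p is the length of this list and
  -- its r-th edge is {p_{r-1}, p_r}.
  Walk : Fin n → List (Fin n) → Set
  Walk b []       = ⊤
  Walk b (x ∷ xs) = Adj b x × Walk x xs

  Connected : Set
  Connected = ∀ u v → Σ (List (Fin n)) λ ps → Walk u ps × (v ≡ u ⊎ Σ (List (Fin n)) λ ps' → ps ≡ ps' ++ (v ∷ []))

_⊑_ : {A : Set} → List A → List A → Set
ps ⊑ qs = Σ _ λ rs → qs ≡ ps ++ rs

module _ {m : ℕ} where
  vtx : Fin m → List (Fin m) → ℕ → Fin m
  vtx b ps       zero    = b
  vtx b []       (suc i) = b        -- out of range (junk)
  vtx b (x ∷ xs) (suc i) = vtx x xs i

  memb : Fin m → List (Fin m) → Bool
  memb y []       = false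
  memb y (x ∷ xs) with y ≟ x
  ... | yes _ = true
  ... | no  _ = memb y xs

  distinctPrefixLen : List (Fin m) → List (Fin m) → ℕ
  distinctPrefixLen seen []       = 0
  distinctPrefixLen seen (y ∷ ys) with memb y seen
  ... | true  = 0
  ... | false = suc (distinctPrefixLen (y ∷ seen) ys)

  -- Block lengths (numbers of edges) of the factorization
  -- p = p⁽¹⁾ ⋯ p⁽ⁿ⁾, computed from the end: the argument is the REVERSED
  -- vertex list p_k, …, p_0 of (a prefix of) the path.  The last block is
  -- the longest cycle-free suffix, i.e. it has (#distinct-prefix − 1) edges
  -- (at least 1, which always holds for loop-free graphs); then recurse on
  -- the remaining prefix (which shares the junction vertex).  The first
  -- argument is fuel (the vertex count suffices).  Output: last block first.
  blocksRev : ℕ → List (Fin m) → List ℕ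
  blocksRev zero    _            = []
  blocksRev (suc f) []           = []
  blocksRev (suc f) (x ∷ [])     = []
  blocksRev (suc f) (x ∷ y ∷ zs) =
    let e = suc (distinctPrefixLen [] (x ∷ y ∷ zs) ∸ 2)
    in e ∷ blocksRev f (drop e (x ∷ y ∷ zs))

  blocks : Fin m → List (Fin m) → List ℕ
  blocks b ps = reverse (blocksRev (suc (length ps)) (reverse (b ∷ ps)))

  nBlocks : Fin m → List (Fin m) → ℕ
  nBlocks b ps = length (blocks b ps)

  -- index (1-based) of the block containing the r-th edge
  blockIdx : List ℕ → ℕ → ℕ
  blockIdx []       r = 0
  blockIdx (l ∷ ls) r with r ≤ᵇ l
  ... | true  = 1
  ... | false = suc (blockIdx ls (r ∸ l))

  d : Fin m → List (Fin m) → ℕ → ℕ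
  d b ps r = blockIdx (blocks b ps) r

data ℕ∞ : Set where
  fin : ℕ → ℕ∞
  ∞   : ℕ∞

data _≤∞_ : ℕ∞ → ℕ∞ → Set where
  fin≤fin : ∀ {a c} → a ≤ c → fin a ≤∞ fin c
  _≤∞∞    : ∀ x → x ≤∞ ∞

min∞ : ℕ∞ → ℕ∞ → ℕ∞
min∞ (fin a) (fin c) = fin (a ⊓ c)
min∞ (fin a) ∞       = fin a
min∞ ∞       y       = y

module _ (G : Graph) (b : Fin (Graph.n G)) (ℓ : ℕ) where
  open Graph G

  -- (G,b,ℓ)-tableaux (p, L); L : [1,#p] → ℤ≥0 given as a function ℕ → ℕ
  -- of which only the values on [1,#p] matter.
  IsTableau : List (Fin n) → (ℕ → ℕ) → Set
  IsTableau ps L =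
      Walk G b ps
    × (∀ i j → 1 ≤ i → i ≤ j → j ≤ length ps → L i ≤ L j)
    × (∀ i j → 1 ≤ i → i < j → j ≤ length ps →
         vtx b ps (i ∸ 1) ≡ vtx b ps j → L i < L j)
    × (L (length ps) + length ps ≤ ℓ)

  -- extended q-tableaux: U : [1,#q] → ℤ≥0 ∪ {∞}, given as ℕ → ℕ∞ of which
  -- only the values on [1,#q] matter.
  module _ (qs : List (Fin n)) where
    InDom : ℕ → Set
    InDom i = 1 ≤ i × i ≤ length qs

    IsExtTab : (ℕ → ℕ∞) → Set
    IsExtTab U =
        (∀ i j → InDom i → InDom j → i ≤ j → U i ≤∞ U j)
      × (∀ m k → InDom m → U m ≡ fin k →
           Σ (ℕ → ℕ) λ L → (∀ i → 1 ≤ i → i ≤ m → U i ≡ fin (L i))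
                         × IsTableau (take m qs) L)

    _≐_ : (ℕ → ℕ∞) → (ℕ → ℕ∞) → Set
    U ≐ U' = ∀ i → InDom i → U i ≡ U' i

    _⪯∞_ : (ℕ → ℕ∞) → (ℕ → ℕ∞) → Set
    U ⪯∞ U' = ∀ i → InDom i → U' i ≤∞ U i

    _∨∞_ : (ℕ → ℕ∞) → (ℕ → ℕ∞) → (ℕ → ℕ∞)
    (U ∨∞ U') i = min∞ (U i) (U' i)

    JoinIrreducible : (ℕ → ℕ∞) → Set
    JoinIrreducible U =
        IsExtTab U
      × ¬ (∀ V → IsExtTab V → U ⪯∞ V)
      × (∀ V W → IsExtTab V → IsExtTab W → U ≐ (V ∨∞ W) → (U ≐ V) ⊎ (U ≐ W))

    InIPq : List (Fin n) → ℕ → Set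
    InIPq ps a =
        ps ⊑ qs
      × Walk G b ps
      × 1 ≤ length ps
      × (a + length ps + nBlocks b ps ≤ ℓ + 1)   -- 0 ≤ a ≤ ℓ+1−#p−n_p

  _⪯IP_ : (List (Fin n) × ℕ) → (List (Fin n) × ℕ) → Set
  (ps , a) ⪯IP (rs , c) = ps ⊑ rs × (d b rs (length ps) + c ≤ nBlocks b ps + a)

  gτ : List (Fin n) → ℕ → (ℕ → ℕ∞)
  gτ ps a r with r ≤ᵇ length ps
  ... | true  = fin (d b ps r + a ∸ 1)
  ... | false = ∞

{-# OPTIONS --safe #-}
module Submission where

-- Peeling off the last block shows that the block index d_p has the smallest increments among
-- all labellings L of p satisfying (i) and (ii): L(j) + n_p ≤ L(#p) + d_p(j). Hence L_⟨p,a⟩ is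
-- the pointwise largest tableau on p whose last label is n_p + a − 1. If g^q(τ⟨p,a⟩) = V ∨ W,
-- one of V, W takes this value at #p, and maximality forces it to agree with g^q(τ⟨p,a⟩)
-- everywhere. Conversely, if m is the last finite position of a join-irreducible U, then U is
-- the join of g^q(τ⟨q₁⋯q_m, a⟩), for the a matching the last labels, and of U cut off before m;
-- the latter differs from U at m. The order comparison is the same maximality, applied to the
-- restriction of L_⟨r,c⟩ to p.

open import Data.Bool using (true; false; T)
open import Data.Empty using (⊥-elim)
open import Data.Fin using (Fin)
open import Data.Fin.Properties using () renaming (_≟_ to _≟ᶠ_)
open import Data.Nat using (ℕ; zero; suc; _+_; _∸_; _≤_; _<_; _≤ᵇ_; z≤n; s≤s; _≤?_; _<?_)
open import Data.Nat.ListAction using (sum)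
open import Data.Nat.ListAction.Properties using (sum-++)
open import Data.Nat.Properties
open import Data.Nat.Tactic.RingSolver using (solve-∀)
open import Data.List using (List; []; _∷_; _++_; length; take; drop; reverse; [_])
open import Data.List.Properties
  using (unfold-reverse; reverse-++; reverse-involutive; length-reverse; length-++; ++-assoc;
         ∷-injective; ∷-injectiveʳ; length-take; length-drop; take++drop≡id)
open import Data.List.Relation.Unary.All as All using (All; []; _∷_)
open import Data.List.Relation.Unary.AllPairs.Properties as AllPairs using ()
open import Data.List.Relation.Unary.Any using (here; there)
open import Data.List.Relation.Unary.Any.Properties as Any using ()
open import Data.List.Relation.Unary.Unique.Propositional using (Unique; []; _∷_)
open import Data.List.Membership.Propositional using (_∈_; _∉_)
open import Data.Product using (Σ; ∃₂; _×_; _,_; proj₁; proj₂)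
open import Data.Sum using (_⊎_; inj₁; inj₂)
open import Data.Unit using (tt)
open import Function using (case_of_)
open import Relation.Nullary using (¬_; yes; no)
open import Relation.Binary.Definitions using (tri<; tri≈; tri>)
open import Relation.Binary.PropositionalEquality hiding ([_])

open import Defs

module _ {A : Set} where

  nth : A → List A → ℕ → A
  nth d []       i       = d
  nth d (x ∷ xs) zero    = x
  nth d (x ∷ xs) (suc i) = nth d xs i

  nth-++ʳ : ∀ d (xs ys : List A) i → nth d (xs ++ ys) (length xs + i) ≡ nth d ys i
  nth-++ʳ d []       ys i = refl
  nth-++ʳ d (x ∷ xs) ys i = nth-++ʳ d xs ys i

  nth-default-irrelevant : ∀ d d' xs i → i < length xs → nth d xs i ≡ nth d' xs i
  nth-default-irrelevant d d' (x ∷ xs) zero    _       = refl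
  nth-default-irrelevant d d' (x ∷ xs) (suc i) (s≤s l) = nth-default-irrelevant d d' xs i l

  All-nth : ∀ {P : A → Set} d {xs} → All P xs → ∀ i → i < length xs → P (nth d xs i)
  All-nth d (px ∷ _)   zero    _       = px
  All-nth d (_  ∷ pxs) (suc i) (s≤s l) = All-nth d pxs i l

  Unique-nth-injective : ∀ d {xs} → Unique xs → ∀ i j → i < j → j < length xs → nth d xs i ≢ nth d xs j
  Unique-nth-injective d (px ∷ u) zero    (suc j) _        (s≤s jl) = All-nth d px j jl
  Unique-nth-injective d (px ∷ u) (suc i) (suc j) (s≤s ij) (s≤s jl) = Unique-nth-injective d u i j ij jl

  ∈⇒nth : ∀ d {x xs} → x ∈ xs → Σ ℕ λ j → j < length xs × nth d xs j ≡ x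
  ∈⇒nth d (here refl) = zero , s≤s z≤n , refl
  ∈⇒nth d (there x∈) with ∈⇒nth d x∈
  ... | j , j< , eq = suc j , s≤s j< , eq

  Unique-reverse : ∀ {xs : List A} → Unique xs → Unique (reverse xs)
  Unique-reverse [] = []
  Unique-reverse {x ∷ xs} (x∉ ∷ u) rewrite unfold-reverse x xs =
    AllPairs.++⁺ (Unique-reverse u) ([] ∷ [])
      (All.tabulate λ y∈ → (λ y≡x → All.lookup x∉ (Any.reverse⁻ {xs = xs} y∈) (sym y≡x)) ∷ [])

  take-++-length : ∀ n (xs ys : List A) → length xs ≡ n → take n (xs ++ ys) ≡ xs
  take-++-length _ []       ys refl = refl
  take-++-length _ (x ∷ xs) ys refl = cong (x ∷_) (take-++-length _ xs ys refl)

  drop-++-length : ∀ n (xs ys : List A) → length xs ≡ n → drop n (xs ++ ys) ≡ ys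
  drop-++-length _ []       ys refl = refl
  drop-++-length _ (x ∷ xs) ys refl = drop-++-length _ xs ys refl

  length-take-≤ : ∀ n (xs : List A) → n ≤ length xs → length (take n xs) ≡ n
  length-take-≤ n xs n≤ = trans (length-take n xs) (m≤n⇒m⊓n≡m n≤)

  length-drop-≤ : ∀ n (xs : List A) → length (drop n xs) ≤ length xs
  length-drop-≤ n xs = subst (_≤ length xs) (sym (length-drop n xs)) (m∸n≤m (length xs) n)

  ∷-unsnoc : ∀ (x : A) xs → ∃₂ λ ys z → x ∷ xs ≡ ys ++ [ z ]
  ∷-unsnoc x []       = [] , x , refl
  ∷-unsnoc x (y ∷ xs) with ∷-unsnoc y xs
  ... | ys , z , eq = x ∷ ys , z , cong (x ∷_) eq

  ⊑-length : ∀ {ps qs : List A} → ps ⊑ qs → length ps ≤ length qs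
  ⊑-length {ps} (rs , refl) = subst (length ps ≤_) (sym (length-++ ps)) (m≤m+n _ _)

  ⊑⇒take-length : ∀ {ps qs : List A} → ps ⊑ qs → take (length ps) qs ≡ ps
  ⊑⇒take-length {ps} (rs , refl) = take-++-length _ ps rs refl

  take-⊑ : ∀ n (qs : List A) → take n qs ⊑ qs
  take-⊑ n qs = drop n qs , sym (take++drop≡id n qs)

  ⊑-length-injective : ∀ {ps rs qs : List A} → ps ⊑ qs → rs ⊑ qs → length ps ≡ length rs → ps ≡ rs
  ⊑-length-injective {qs = qs} ps⊑ rs⊑ eq =
    trans (sym (⊑⇒take-length ps⊑)) (trans (cong (λ n → take n qs) eq) (⊑⇒take-length rs⊑))

  ⊑-by-length : ∀ {ps rs qs : List A} → ps ⊑ qs → rs ⊑ qs → length ps ≤ length rs → ps ⊑ rs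
  ⊑-by-length {[]}     {rs}              _ _ _ = rs , refl
  ⊑-by-length {x ∷ ps} {y ∷ rs} {z ∷ qs} (t , e) (t' , e') (s≤s l)
    with ∷-injective e | ∷-injective e'
  ... | refl , e₁ | refl , e₁' with ⊑-by-length {ps} {rs} {qs} (t , e₁) (t' , e₁') l
  ... | u , eq = u , cong (x ∷_) eq

  ⊑⇒take≡take : ∀ {ps qs : List A} m → ps ⊑ qs → m ≤ length ps → take m qs ≡ take m ps
  ⊑⇒take≡take              zero    _           _        = refl
  ⊑⇒take≡take {x ∷ ps} (suc m) (rs , refl) (s≤s m≤) = cong (x ∷_) (⊑⇒take≡take m (rs , refl) m≤)

≤ᵇ≡true⇒≤ : ∀ {r l} → (r ≤ᵇ l) ≡ true → r ≤ l
≤ᵇ≡true⇒≤ {r} {l} eq = ≤ᵇ⇒≤ r l (subst T (sym eq) tt)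

≤ᵇ≡false⇒> : ∀ {r l} → (r ≤ᵇ l) ≡ false → l < r
≤ᵇ≡false⇒> eq = ≰⇒> (λ r≤l → subst T eq (≤⇒≤ᵇ r≤l))

module _ {m : ℕ} where

  memb≡true⇒∈ : ∀ (y : Fin m) seen → memb y seen ≡ true → y ∈ seen
  memb≡true⇒∈ y (x ∷ seen) eq with y ≟ᶠ x
  ... | yes y≡x = here y≡x
  ... | no  _   = there (memb≡true⇒∈ y seen eq)

  memb≡false⇒∉ : ∀ (y : Fin m) seen → memb y seen ≡ false → y ∉ seen
  memb≡false⇒∉ y (x ∷ seen) eq with y ≟ᶠ x
  memb≡false⇒∉ y (x ∷ seen) () | yes _
  memb≡false⇒∉ y (x ∷ seen) eq | no  y≢x = λ { (here y≡x) → y≢x y≡x ; (there y∈) → memb≡false⇒∉ y seen eq y∈ }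

  distinctPrefixLen-seen : ∀ {y : Fin m} {seen} ys → memb y seen ≡ true → distinctPrefixLen seen (y ∷ ys) ≡ 0
  distinctPrefixLen-seen ys eq rewrite eq = refl

  distinctPrefixLen-fresh : ∀ {y : Fin m} {seen} ys → memb y seen ≡ false
    → distinctPrefixLen seen (y ∷ ys) ≡ suc (distinctPrefixLen (y ∷ seen) ys)
  distinctPrefixLen-fresh ys eq rewrite eq = refl

  record DistinctPrefix (seen xs : List (Fin m)) : Set where
    field
      front rest   : List (Fin m)
      split        : xs ≡ front ++ rest
      length-front : length front ≡ distinctPrefixLen seen xs
      unique       : Unique front
      fresh        : All (_∉ seen) front
      blocked      : ∀ {y rest′} → rest ≡ y ∷ rest′ → y ∈ seen ⊎ y ∈ front

  distinctPrefix : ∀ seen xs → DistinctPrefix seen xs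
  distinctPrefix seen [] = record
    { front = [] ; rest = [] ; split = refl ; length-front = refl ; unique = [] ; fresh = [] ; blocked = λ () }
  distinctPrefix seen (y ∷ ys) with memb y seen in eq
  ... | true = record
    { front = [] ; rest = y ∷ ys ; split = refl ; length-front = sym (distinctPrefixLen-seen ys eq)
    ; unique = [] ; fresh = []
    ; blocked = λ { refl → inj₁ (memb≡true⇒∈ y seen eq) } }
  ... | false = record
    { front        = y ∷ front
    ; rest         = rest
    ; split        = cong (y ∷_) split
    ; length-front = trans (cong suc length-front) (sym (distinctPrefixLen-fresh ys eq))
    ; unique       = All.map (λ z∉ y≡z → z∉ (here (sym y≡z))) fresh ∷ unique
    ; fresh        = memb≡false⇒∉ y seen eq ∷ All.map (λ z∉ z∈ → z∉ (there z∈)) fresh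
    ; blocked      = λ rest≡ → shift (blocked rest≡)
    }
    where
      open DistinctPrefix (distinctPrefix (y ∷ seen) ys)
      shift : ∀ {z} → z ∈ y ∷ seen ⊎ z ∈ front → z ∈ seen ⊎ z ∈ y ∷ front
      shift (inj₁ (here z≡y)) = inj₂ (here z≡y)
      shift (inj₁ (there z∈)) = inj₁ z∈
      shift (inj₂ z∈)         = inj₂ (there z∈)

  blocksRev-fuel : ∀ f g (R : List (Fin m)) → length R ≤ f → length R ≤ g → blocksRev f R ≡ blocksRev g R
  blocksRev-fuel zero    zero    R            _        _        = refl
  blocksRev-fuel zero    (suc g) []           _        _        = refl
  blocksRev-fuel (suc f) zero    []           _        _        = refl
  blocksRev-fuel (suc f) (suc g) []           _        _        = refl
  blocksRev-fuel (suc f) (suc g) (x ∷ [])     _        _        = refl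
  blocksRev-fuel (suc f) (suc g) (x ∷ y ∷ zs) (s≤s lf) (s≤s lg) =
    cong (e ∷_) (blocksRev-fuel f g (drop e (x ∷ y ∷ zs))
                   (≤-trans (length-drop-≤ e′ (y ∷ zs)) lf) (≤-trans (length-drop-≤ e′ (y ∷ zs)) lg))
    where
      e′ = distinctPrefixLen [] (x ∷ y ∷ zs) ∸ 2
      e  = suc e′

  blocksRev-unfold : ∀ f (R : List (Fin m)) → 2 ≤ distinctPrefixLen [] R
    → blocksRev (suc f) R ≡ (distinctPrefixLen [] R ∸ 1) ∷ blocksRev f (drop (distinctPrefixLen [] R ∸ 1) R)
  blocksRev-unfold f (x ∷ []) (s≤s ())
  blocksRev-unfold f (x ∷ y ∷ zs) D≥2 =
    cong (λ e → e ∷ blocksRev f (drop e (x ∷ y ∷ zs))) (suc-∸2 D≥2)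
    where
      suc-∸2 : ∀ {D} → 2 ≤ D → suc (D ∸ 2) ≡ D ∸ 1
      suc-∸2 (s≤s (s≤s _)) = refl

  blockIdx-∷ʳ-inner : ∀ ls e r → 1 ≤ r → r ≤ sum ls → blockIdx {m} (ls ++ [ e ]) r ≡ blockIdx {m} ls r
  blockIdx-∷ʳ-inner []       e (suc r) _ ()
  blockIdx-∷ʳ-inner (l ∷ ls) e r r≥1 r≤ with r ≤ᵇ l in eq
  ... | true  = refl
  ... | false = cong suc (blockIdx-∷ʳ-inner ls e (r ∸ l) (m<n⇒0<n∸m (≤ᵇ≡false⇒> {r} {l} eq))
                   (subst (r ∸ l ≤_) (m+n∸m≡n l (sum ls)) (∸-monoˡ-≤ l r≤)))

  blockIdx-∷ʳ-last : ∀ ls e r → sum ls < r → blockIdx {m} (ls ++ [ e ]) r ≡ suc (length ls)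
  blockIdx-∷ʳ-last [] e r _ with r ≤ᵇ e
  ... | true  = refl
  ... | false = refl
  blockIdx-∷ʳ-last (l ∷ ls) e r r> with r ≤ᵇ l in eq
  ... | true  = ⊥-elim (<⇒≱ r> (≤-trans (≤ᵇ≡true⇒≤ {r} {l} eq) (m≤m+n l (sum ls))))
  ... | false = cong suc (blockIdx-∷ʳ-last ls e (r ∸ l)
                   (subst (_< r ∸ l) (m+n∸m≡n l (sum ls)) (∸-monoˡ-< r> (m≤m+n l (sum ls)))))

  vtx≡nth : ∀ (b : Fin m) ps i → i ≤ length ps → vtx b ps i ≡ nth b (b ∷ ps) i
  vtx≡nth b ps       zero    _       = refl
  vtx≡nth b (x ∷ ps) (suc i) (s≤s l) = trans (vtx≡nth x ps i l) (nth-default-irrelevant x b (x ∷ ps) i (s≤s l))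

  vtx-++ : ∀ (b : Fin m) ps rs i → i ≤ length ps → vtx b (ps ++ rs) i ≡ vtx b ps i
  vtx-++ b ps       rs zero    _       = refl
  vtx-++ b (x ∷ ps) rs (suc i) (s≤s l) = vtx-++ x ps rs i l

  vtx-take : ∀ (b : Fin m) ps s i → i ≤ s → s ≤ length ps → vtx b (take s ps) i ≡ vtx b ps i
  vtx-take b ps s i i≤s s≤ = trans (sym (vtx-++ b (take s ps) (drop s ps) i i≤))
                                  (cong (λ qs → vtx b qs i) (take++drop≡id s ps))
    where i≤ = subst (i ≤_) (sym (length-take-≤ s ps s≤)) i≤s

  record LastBlock (b : Fin m) (ps : List (Fin m)) : Set where
    field
      start        : ℕ
      start<length : start < length ps
      blocks-∷ʳ    : blocks b ps ≡ blocks b (take start ps) ++ [ length ps ∸ start ]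
      cycle-free   : ∀ i j → start ≤ i → i < j → j ≤ length ps → vtx b ps i ≢ vtx b ps j
      longest      : 1 ≤ start → Σ ℕ λ j → start < j × j ≤ length ps × vtx b ps (start ∸ 1) ≡ vtx b ps j

module Walks (G : Graph) where
  open Graph G using (Adj; irrefl) renaming (n to N)

  walk-take : ∀ {b : Fin N} {ps} s → Walk G b ps → Walk G b (take s ps)
  walk-take         zero    _       = tt
  walk-take {ps = []}     (suc s) _       = tt
  walk-take {ps = x ∷ ps} (suc s) (a , w) = a , walk-take s w

  walk-adj : ∀ {b : Fin N} {ps} xs {u v ys} → Walk G b ps → b ∷ ps ≡ xs ++ u ∷ v ∷ ys → Adj u v
  walk-adj {ps = _ ∷ _} []          (a , _) refl = a
  walk-adj {ps = _ ∷ _} (x ∷ xs)    (_ , w) eq   = walk-adj xs w (∷-injectiveʳ eq)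
  walk-adj {ps = []}    (x ∷ [])    _       ()
  walk-adj {ps = []}    (x ∷ _ ∷ _) _       ()

  module LastBlockOf
    {b : Fin N} {ps : List (Fin N)} (w : Walk G b ps)
    (P : List (Fin N)) (w′ : Fin N) (Y : List (Fin N))
    (split        : reverse (b ∷ ps) ≡ (P ++ [ w′ ]) ++ Y)
    (length-front : length (P ++ [ w′ ]) ≡ distinctPrefixLen [] (reverse (b ∷ ps)))
    (unique       : Unique (P ++ [ w′ ]))
    (blocked      : ∀ {y Y′} → Y ≡ y ∷ Y′ → y ∈ [] ⊎ y ∈ P ++ [ w′ ])
    (P-nonempty   : 1 ≤ length P)
    where
    -- blocks reads the vertex list backwards: the longest distinct prefix P ++ [ w′ ] of the
    -- reversed list is the last block, and w′ is its first vertex p_s.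
    open ≡-Reasoning

    e s k : ℕ
    e = length P
    s = length Y
    k = length ps

    length-P∷ʳ : length (P ++ [ w′ ]) ≡ suc e
    length-P∷ʳ = trans (length-++ P) (+-comm e 1)

    k≡e+s : k ≡ e + s
    k≡e+s = suc-injective (begin
      suc k                          ≡⟨ sym (length-reverse (b ∷ ps)) ⟩
      length (reverse (b ∷ ps))      ≡⟨ cong length split ⟩
      length ((P ++ [ w′ ]) ++ Y)    ≡⟨ length-++ (P ++ [ w′ ]) ⟩
      length (P ++ [ w′ ]) + s       ≡⟨ cong (_+ s) length-P∷ʳ ⟩
      suc e + s                      ∎)

    s<k : s < k
    s<k = subst (s <_) (sym k≡e+s) (m<n+m s P-nonempty)

    k∸s≡e : k ∸ s ≡ e
    k∸s≡e = trans (cong (_∸ s) k≡e+s) (m+n∸n≡m e s)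

    vertices : b ∷ ps ≡ reverse Y ++ w′ ∷ reverse P
    vertices = begin
      b ∷ ps                               ≡⟨ sym (reverse-involutive (b ∷ ps)) ⟩
      reverse (reverse (b ∷ ps))           ≡⟨ cong reverse split ⟩
      reverse ((P ++ [ w′ ]) ++ Y)         ≡⟨ reverse-++ (P ++ [ w′ ]) Y ⟩
      reverse Y ++ reverse (P ++ [ w′ ])   ≡⟨ cong (reverse Y ++_) (reverse-++ P [ w′ ]) ⟩
      reverse Y ++ w′ ∷ reverse P          ∎

    initial-vertices : b ∷ take s ps ≡ reverse Y ++ [ w′ ]
    initial-vertices = begin
      b ∷ take s ps                                   ≡⟨ cong (take (suc s)) vertices ⟩
      take (suc s) (reverse Y ++ w′ ∷ reverse P)      ≡⟨ cong (take (suc s)) (sym (++-assoc (reverse Y) [ w′ ] (reverse P))) ⟩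
      take (suc s) ((reverse Y ++ [ w′ ]) ++ reverse P) ≡⟨ take-++-length (suc s) _ (reverse P) length-Y∷ʳ ⟩
      reverse Y ++ [ w′ ]                             ∎
      where
        length-Y∷ʳ : length (reverse Y ++ [ w′ ]) ≡ suc s
        length-Y∷ʳ = trans (length-++ (reverse Y)) (trans (cong (_+ 1) (length-reverse Y)) (+-comm s 1))

    reverse-initial-vertices : reverse (b ∷ take s ps) ≡ w′ ∷ Y
    reverse-initial-vertices = begin
      reverse (b ∷ take s ps)              ≡⟨ cong reverse initial-vertices ⟩
      reverse (reverse Y ++ [ w′ ])        ≡⟨ reverse-++ (reverse Y) [ w′ ] ⟩
      w′ ∷ reverse (reverse Y)             ≡⟨ cong (w′ ∷_) (reverse-involutive Y) ⟩
      w′ ∷ Y                               ∎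

    distinctPrefixLen≡suc-e : distinctPrefixLen [] (reverse (b ∷ ps)) ≡ suc e
    distinctPrefixLen≡suc-e = trans (sym length-front) length-P∷ʳ

    drop-last-block : drop (distinctPrefixLen [] (reverse (b ∷ ps)) ∸ 1) (reverse (b ∷ ps)) ≡ w′ ∷ Y
    drop-last-block = begin
      drop (distinctPrefixLen [] (reverse (b ∷ ps)) ∸ 1) (reverse (b ∷ ps))
        ≡⟨ cong₂ (λ n R → drop (n ∸ 1) R) distinctPrefixLen≡suc-e split ⟩
      drop e ((P ++ [ w′ ]) ++ Y)  ≡⟨ cong (drop e) (++-assoc P [ w′ ] Y) ⟩
      drop e (P ++ w′ ∷ Y)         ≡⟨ drop-++-length e P (w′ ∷ Y) refl ⟩
      w′ ∷ Y                       ∎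

    blocks-∷ʳ : blocks b ps ≡ blocks b (take s ps) ++ [ k ∸ s ]
    blocks-∷ʳ = begin
      reverse (blocksRev (suc k) (reverse (b ∷ ps)))
        ≡⟨ cong reverse (blocksRev-unfold k (reverse (b ∷ ps)) 2≤D) ⟩
      reverse ((D ∸ 1) ∷ blocksRev k (drop (D ∸ 1) (reverse (b ∷ ps))))
        ≡⟨ cong₂ (λ x R → reverse (x ∷ blocksRev k R)) (cong (_∸ 1) distinctPrefixLen≡suc-e) drop-last-block ⟩
      reverse (e ∷ blocksRev k (w′ ∷ Y))
        ≡⟨ unfold-reverse e (blocksRev k (w′ ∷ Y)) ⟩
      reverse (blocksRev k (w′ ∷ Y)) ++ [ e ]
        ≡⟨ cong (λ B → reverse B ++ [ e ]) (blocksRev-fuel k (suc t) (w′ ∷ Y) s<k (s≤s (≤-reflexive (sym length-t)))) ⟩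
      reverse (blocksRev (suc t) (w′ ∷ Y)) ++ [ e ]
        ≡⟨ cong₂ (λ R x → reverse (blocksRev (suc t) R) ++ [ x ]) (sym reverse-initial-vertices) (sym k∸s≡e) ⟩
      blocks b (take s ps) ++ [ k ∸ s ] ∎
      where
        D = distinctPrefixLen [] (reverse (b ∷ ps))
        t = length (take s ps)
        length-t : t ≡ s
        length-t = length-take-≤ s ps (<⇒≤ s<k)
        2≤D : 2 ≤ D
        2≤D = subst (2 ≤_) (sym distinctPrefixLen≡suc-e) (s≤s P-nonempty)

    vtx-last-block : ∀ j → j ≤ e → vtx b ps (s + j) ≡ nth b (w′ ∷ reverse P) j
    vtx-last-block j j≤e = begin
      vtx b ps (s + j)                                    ≡⟨ vtx≡nth b ps (s + j) s+j≤k ⟩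
      nth b (b ∷ ps) (s + j)                              ≡⟨ cong (λ V → nth b V (s + j)) vertices ⟩
      nth b (reverse Y ++ w′ ∷ reverse P) (s + j)
        ≡⟨ cong (λ z → nth b (reverse Y ++ w′ ∷ reverse P) (z + j)) (sym (length-reverse Y)) ⟩
      nth b (reverse Y ++ w′ ∷ reverse P) (length (reverse Y) + j) ≡⟨ nth-++ʳ b (reverse Y) (w′ ∷ reverse P) j ⟩
      nth b (w′ ∷ reverse P) j                            ∎
      where
        s+j≤k : s + j ≤ k
        s+j≤k = subst (s + j ≤_) (trans (+-comm s e) (sym k≡e+s)) (+-monoʳ-≤ s j≤e)

    unique-last-block : Unique (w′ ∷ reverse P)
    unique-last-block = subst Unique (reverse-++ P [ w′ ]) (Unique-reverse unique)

    cycle-free : ∀ i j → s ≤ i → i < j → j ≤ k → vtx b ps i ≢ vtx b ps j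
    cycle-free i j s≤i i<j j≤k eq =
      Unique-nth-injective b unique-last-block (i ∸ s) (j ∸ s) (∸-monoˡ-< i<j s≤i) j∸s<
        (trans (sym (local i s≤i (<⇒≤ i<j))) (trans eq (local j (≤-trans s≤i (<⇒≤ i<j)) ≤-refl)))
      where
        j∸s≤e : j ∸ s ≤ e
        j∸s≤e = subst (j ∸ s ≤_) k∸s≡e (∸-monoˡ-≤ s j≤k)
        j∸s< : j ∸ s < length (w′ ∷ reverse P)
        j∸s< = s≤s (subst (j ∸ s ≤_) (sym (length-reverse P)) j∸s≤e)
        local : ∀ x → s ≤ x → x ≤ j → vtx b ps x ≡ nth b (w′ ∷ reverse P) (x ∸ s)
        local x s≤x x≤j = trans (cong (vtx b ps) (sym (m+[n∸m]≡n s≤x)))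
                                (vtx-last-block (x ∸ s) (≤-trans (∸-monoˡ-≤ s x≤j) j∸s≤e))

    module _ {y Y′} (Y≡ : Y ≡ y ∷ Y′) where

      vertices-around-start : b ∷ ps ≡ reverse Y′ ++ y ∷ w′ ∷ reverse P
      vertices-around-start = begin
        b ∷ ps                            ≡⟨ vertices ⟩
        reverse Y ++ w′ ∷ reverse P       ≡⟨ cong (λ Z → reverse Z ++ w′ ∷ reverse P) Y≡ ⟩
        reverse (y ∷ Y′) ++ w′ ∷ reverse P ≡⟨ cong (_++ w′ ∷ reverse P) (unfold-reverse y Y′) ⟩
        (reverse Y′ ++ [ y ]) ++ w′ ∷ reverse P ≡⟨ ++-assoc (reverse Y′) [ y ] (w′ ∷ reverse P) ⟩
        reverse Y′ ++ y ∷ w′ ∷ reverse P  ∎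

      vtx-before-start : vtx b ps (s ∸ 1) ≡ y
      vtx-before-start = begin
        vtx b ps (s ∸ 1)                  ≡⟨ cong (λ Z → vtx b ps (length Z ∸ 1)) Y≡ ⟩
        vtx b ps (length Y′)              ≡⟨ vtx≡nth b ps (length Y′) Y′≤k ⟩
        nth b (b ∷ ps) (length Y′)
          ≡⟨ cong₂ (nth b) vertices-around-start (sym (trans (+-identityʳ _) (length-reverse Y′))) ⟩
        nth b (reverse Y′ ++ y ∷ w′ ∷ reverse P) (length (reverse Y′) + 0) ≡⟨ nth-++ʳ b (reverse Y′) _ 0 ⟩
        y                                 ∎
        where
          Y′≤k : length Y′ ≤ k
          Y′≤k = ≤-trans (n≤1+n _) (<⇒≤ (subst (_< k) (cong length Y≡) s<k))

      y∈last-block : y ∈ w′ ∷ reverse P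
      y∈last-block with blocked Y≡
      ... | inj₂ y∈ = subst (y ∈_) (reverse-++ P [ w′ ]) (Any.reverse⁺ y∈)

      longest-from : Σ ℕ λ j → s < j × j ≤ k × vtx b ps (s ∸ 1) ≡ vtx b ps j
      longest-from with ∈⇒nth b y∈last-block
      ... | zero , _ , w′≡y =
        ⊥-elim (irrefl (subst (Adj y) w′≡y (walk-adj (reverse Y′) w vertices-around-start)))
      ... | suc j , sj< , nth≡y =
        s + suc j , m<m+n s (s≤s z≤n) , s+sj≤k ,
        trans vtx-before-start (sym (trans (vtx-last-block (suc j) sj≤e) nth≡y))
        where
          sj≤e : suc j ≤ e
          sj≤e = subst (suc j ≤_) (length-reverse P) (≤-pred sj<)
          s+sj≤k : s + suc j ≤ k
          s+sj≤k = subst (s + suc j ≤_) (trans (+-comm s e) (sym k≡e+s)) (+-monoʳ-≤ s sj≤e)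

    longest : 1 ≤ s → Σ ℕ λ j → s < j × j ≤ k × vtx b ps (s ∸ 1) ≡ vtx b ps j
    longest 1≤s = by-cases Y refl
      where
        by-cases : ∀ Z → Y ≡ Z → Σ ℕ λ j → s < j × j ≤ k × vtx b ps (s ∸ 1) ≡ vtx b ps j
        by-cases []      Y≡ = ⊥-elim (<-irrefl refl (subst (1 ≤_) (cong length Y≡) 1≤s))
        by-cases (_ ∷ _) Y≡ = longest-from Y≡

    lastBlock : LastBlock b ps
    lastBlock = record
      { start = s ; start<length = s<k ; blocks-∷ʳ = blocks-∷ʳ ; cycle-free = cycle-free ; longest = longest }

  lastBlock : ∀ {b ps} → Walk G b ps → 1 ≤ length ps → LastBlock b ps
  lastBlock {b} {ps} w 1≤k = fromPrefix (distinctPrefix [] (reverse (b ∷ ps)))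
    where
      length-R : ∀ {R} → reverse (b ∷ ps) ≡ R → suc (length ps) ≡ length R
      length-R R≡ = trans (sym (length-reverse (b ∷ ps))) (cong length R≡)

      fromPrefix : DistinctPrefix [] (reverse (b ∷ ps)) → LastBlock b ps
      fromPrefix record { front = [] ; rest = [] ; split = split } with length-R split
      ... | ()
      fromPrefix record { front = [] ; rest = y ∷ _ ; blocked = blocked } with blocked refl
      ... | inj₁ ()
      ... | inj₂ ()
      fromPrefix record { front = x ∷ [] ; rest = [] ; split = split } =
        ⊥-elim (<-irrefl (sym (suc-injective (length-R split))) 1≤k)
      fromPrefix record { front = x ∷ [] ; rest = y ∷ Y′ ; split = split ; blocked = blocked } with blocked refl
      ... | inj₁ ()
      ... | inj₂ (there ())
      ... | inj₂ (here refl) = ⊥-elim (irrefl (walk-adj (reverse Y′) w vertices))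
        where
          vertices : b ∷ ps ≡ reverse Y′ ++ y ∷ y ∷ []
          vertices = trans (sym (reverse-involutive (b ∷ ps))) (trans (cong reverse split) (reverse-++ (y ∷ y ∷ []) Y′))
      fromPrefix record { front = x₀ ∷ x₁ ∷ X ; rest = Y ; split = split ; length-front = length-front
                        ; unique = unique ; blocked = blocked }
        with ∷-unsnoc x₀ (x₁ ∷ X)
      ... | P , w′ , X≡ = LastBlockOf.lastBlock w P w′ Y
        (subst (λ F → reverse (b ∷ ps) ≡ F ++ Y) X≡ split)
        (subst (λ F → length F ≡ distinctPrefixLen [] (reverse (b ∷ ps))) X≡ length-front)
        (subst Unique X≡ unique)
        (λ Y≡ → subst (λ F → _ ∈ [] ⊎ _ ∈ F) X≡ (blocked Y≡))
        (P-nonempty P X≡)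
        where
          P-nonempty : ∀ P → x₀ ∷ x₁ ∷ X ≡ P ++ [ w′ ] → 1 ≤ length P
          P-nonempty []      eq = case ∷-injectiveʳ eq of λ ()
          P-nonempty (_ ∷ _) _  = s≤s z≤n

module _ {m : ℕ} (b : Fin m) where

  Monotone : List (Fin m) → (ℕ → ℕ) → Set
  Monotone ps L = ∀ i j → 1 ≤ i → i ≤ j → j ≤ length ps → L i ≤ L j

  StrictOnCycles : List (Fin m) → (ℕ → ℕ) → Set
  StrictOnCycles ps L = ∀ i j → 1 ≤ i → i < j → j ≤ length ps → vtx b ps (i ∸ 1) ≡ vtx b ps j → L i < L j

  record BlockFacts (ps : List (Fin m)) : Set where
    field
      sum-blocks     : sum (blocks b ps) ≡ length ps
      d-positive     : ∀ r → 1 ≤ r → r ≤ length ps → 1 ≤ d b ps r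
      d≤nBlocks      : ∀ r → 1 ≤ r → r ≤ length ps → d b ps r ≤ nBlocks b ps
      d-first        : 1 ≤ length ps → d b ps 1 ≡ 1
      d-last         : 1 ≤ length ps → d b ps (length ps) ≡ nBlocks b ps
      d-monotone     : Monotone ps (d b ps)
      d-strict       : StrictOnCycles ps (d b ps)
      d-gaps-minimal : ∀ L → Monotone ps L → StrictOnCycles ps L →
                       ∀ j → 1 ≤ j → j ≤ length ps → L j + nBlocks b ps ≤ L (length ps) + d b ps j

  blockFacts-[] : BlockFacts []
  blockFacts-[] = record
    { sum-blocks = refl ; d-positive = λ { _ (s≤s _) () } ; d≤nBlocks = λ { _ (s≤s _) () }
    ; d-first = λ () ; d-last = λ ()
    ; d-monotone = λ { _ (suc _) _ (s≤s _) () } ; d-strict = λ { _ (suc _) _ _ () }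
    ; d-gaps-minimal = λ { _ _ _ _ (s≤s _) () } }

  module ExtendByLastBlock (ps : List (Fin m)) (lb : LastBlock b ps) where
    open LastBlock lb renaming (start to s)

    k = length ps
    ps′ = take s ps
    n′ = nBlocks b ps′

    length-ps′ : length ps′ ≡ s
    length-ps′ = length-take-≤ s ps (<⇒≤ start<length)

    nBlocks≡ : nBlocks b ps ≡ suc n′
    nBlocks≡ = trans (cong length blocks-∷ʳ) (trans (length-++ (blocks b ps′)) (+-comm n′ 1))

    n′<nBlocks : n′ < nBlocks b ps
    n′<nBlocks = subst (n′ <_) (sym nBlocks≡) ≤-refl

    to-ps′ : ∀ {r} → r ≤ s → r ≤ length ps′
    to-ps′ = subst (_ ≤_) (sym length-ps′)

    vtx-ps′ : ∀ i → i ≤ s → vtx b ps′ i ≡ vtx b ps i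
    vtx-ps′ i i≤s = vtx-take b ps s i i≤s (<⇒≤ start<length)

    module _ (IH : BlockFacts ps′) where
      module I = BlockFacts IH

      d-inner : ∀ r → 1 ≤ r → r ≤ s → d b ps r ≡ d b ps′ r
      d-inner r 1≤r r≤s = trans (cong (λ B → blockIdx {m} B r) blocks-∷ʳ)
        (blockIdx-∷ʳ-inner {m} (blocks b ps′) (k ∸ s) r 1≤r (subst (r ≤_) (sym (trans I.sum-blocks length-ps′)) r≤s))

      d-outer : ∀ r → s < r → d b ps r ≡ nBlocks b ps
      d-outer r s<r = trans (cong (λ B → blockIdx {m} B r) blocks-∷ʳ)
        (trans (blockIdx-∷ʳ-last {m} (blocks b ps′) (k ∸ s) r (subst (_< r) (sym (trans I.sum-blocks length-ps′)) s<r))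
               (sym nBlocks≡))

      sum-blocks : sum (blocks b ps) ≡ k
      sum-blocks = begin
        sum (blocks b ps)                  ≡⟨ cong sum blocks-∷ʳ ⟩
        sum (blocks b ps′ ++ [ k ∸ s ])    ≡⟨ sum-++ (blocks b ps′) [ k ∸ s ] ⟩
        sum (blocks b ps′) + (k ∸ s + 0)   ≡⟨ cong₂ _+_ (trans I.sum-blocks length-ps′) (+-identityʳ (k ∸ s)) ⟩
        s + (k ∸ s)                        ≡⟨ m+[n∸m]≡n (<⇒≤ start<length) ⟩
        k                                  ∎
        where open ≡-Reasoning

      d-positive : ∀ r → 1 ≤ r → r ≤ k → 1 ≤ d b ps r
      d-positive r 1≤r r≤k with r ≤? s
      ... | yes r≤s = subst (1 ≤_) (sym (d-inner r 1≤r r≤s)) (I.d-positive r 1≤r (to-ps′ r≤s))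
      ... | no  r≰s = subst (1 ≤_) (sym (trans (d-outer r (≰⇒> r≰s)) nBlocks≡)) (s≤s z≤n)

      d-inner≤n′ : ∀ r → 1 ≤ r → r ≤ s → d b ps r ≤ n′
      d-inner≤n′ r 1≤r r≤s = subst (_≤ n′) (sym (d-inner r 1≤r r≤s)) (I.d≤nBlocks r 1≤r (to-ps′ r≤s))

      d≤nBlocks : ∀ r → 1 ≤ r → r ≤ k → d b ps r ≤ nBlocks b ps
      d≤nBlocks r 1≤r r≤k with r ≤? s
      ... | yes r≤s = ≤-trans (d-inner≤n′ r 1≤r r≤s) (<⇒≤ n′<nBlocks)
      ... | no  r≰s = ≤-reflexive (d-outer r (≰⇒> r≰s))

      d-first : 1 ≤ k → d b ps 1 ≡ 1
      d-first _ with 1 ≤? s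
      ... | yes 1≤s = trans (d-inner 1 ≤-refl 1≤s) (I.d-first (to-ps′ 1≤s))
      ... | no  1≰s = trans (d-outer 1 (≰⇒> 1≰s)) (trans nBlocks≡ (cong (λ z → suc (nBlocks b (take z ps))) s≡0))
        where
          s≡0 : s ≡ 0
          s≡0 = n<1⇒n≡0 (≰⇒> 1≰s)

      d-last : 1 ≤ k → d b ps k ≡ nBlocks b ps
      d-last _ = d-outer k start<length

      d-monotone : Monotone ps (d b ps)
      d-monotone i j 1≤i i≤j j≤k with j ≤? s | i ≤? s
      ... | yes j≤s | _ = subst₂ _≤_ (sym (d-inner i 1≤i (≤-trans i≤j j≤s))) (sym (d-inner j (≤-trans 1≤i i≤j) j≤s))
                            (I.d-monotone i j 1≤i i≤j (to-ps′ j≤s))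
      ... | no  j≰s | yes i≤s = subst (d b ps i ≤_) (sym (d-outer j (≰⇒> j≰s)))
                                  (≤-trans (d-inner≤n′ i 1≤i i≤s) (<⇒≤ n′<nBlocks))
      ... | no  j≰s | no  i≰s = ≤-reflexive (trans (d-outer i (≰⇒> i≰s)) (sym (d-outer j (≰⇒> j≰s))))

      d-strict : StrictOnCycles ps (d b ps)
      d-strict i j 1≤i i<j j≤k eq with j ≤? s | i ≤? s
      ... | yes j≤s | _ =
        subst₂ _<_ (sym (d-inner i 1≤i (≤-trans (<⇒≤ i<j) j≤s))) (sym (d-inner j (≤-trans 1≤i (<⇒≤ i<j)) j≤s))
          (I.d-strict i j 1≤i i<j (to-ps′ j≤s)
            (trans (vtx-ps′ (i ∸ 1) (≤-trans (m∸n≤m i 1) (≤-trans (<⇒≤ i<j) j≤s))) (trans eq (sym (vtx-ps′ j j≤s)))))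
      ... | no  j≰s | yes i≤s = subst (d b ps i <_) (sym (d-outer j (≰⇒> j≰s))) (≤-<-trans (d-inner≤n′ i 1≤i i≤s) n′<nBlocks)
      ... | no  j≰s | no  i≰s = ⊥-elim (cycle-free (i ∸ 1) j (s≤pred (≰⇒> i≰s)) (≤-<-trans (m∸n≤m i 1) i<j) j≤k eq)
        where
          s≤pred : ∀ {i} → s < i → s ≤ i ∸ 1
          s≤pred (s≤s s≤i) = s≤i

      d-gaps-minimal : ∀ L → Monotone ps L → StrictOnCycles ps L →
                       ∀ j → 1 ≤ j → j ≤ k → L j + nBlocks b ps ≤ L k + d b ps j
      d-gaps-minimal L mono strict-L j 1≤j j≤k with j ≤? s
      ... | no  j≰s = subst (λ z → L j + nBlocks b ps ≤ L k + z) (sym (d-outer j (≰⇒> j≰s)))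
                        (+-monoˡ-≤ (nBlocks b ps) (mono j k 1≤j j≤k ≤-refl))
      -- The vertex before the last block recurs in it, at j₀, so L still increases strictly after s.
      ... | yes j≤s with longest 1≤s
        where 1≤s = ≤-trans 1≤j j≤s
      ... | j₀ , s<j₀ , j₀≤k , return = begin
        L j + nBlocks b ps    ≡⟨ cong (L j +_) nBlocks≡ ⟩
        L j + suc n′          ≡⟨ +-suc (L j) n′ ⟩
        suc (L j + n′)        ≤⟨ s≤s inner ⟩
        suc (L s + d b ps′ j) ≤⟨ +-monoˡ-≤ (d b ps′ j) (≤-trans (strict-L s j₀ 1≤s s<j₀ j₀≤k return)
                                                             (mono j₀ k 1≤j₀ j₀≤k ≤-refl)) ⟩
        L k + d b ps′ j       ≡⟨ cong (L k +_) (sym (d-inner j 1≤j j≤s)) ⟩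
        L k + d b ps j        ∎
        where
          open ≤-Reasoning
          1≤s = ≤-trans 1≤j j≤s
          1≤j₀ = ≤-trans 1≤s (<⇒≤ s<j₀)
          within : ∀ {x} → x ≤ length ps′ → x ≤ k
          within x≤ = ≤-trans (subst (_ ≤_) length-ps′ x≤) (<⇒≤ start<length)
          mono′ : Monotone ps′ L
          mono′ i i′ 1≤i i≤i′ i′≤ = mono i i′ 1≤i i≤i′ (within i′≤)
          strict′ : StrictOnCycles ps′ L
          strict′ i i′ 1≤i i<i′ i′≤ eq = strict-L i i′ 1≤i i<i′ (within i′≤)
            (trans (sym (vtx-ps′ (i ∸ 1) (≤-trans (m∸n≤m i 1) (<⇒≤ i<i′s)))) (trans eq (vtx-ps′ i′ i′≤s)))
            where
              i′≤s = subst (_ ≤_) length-ps′ i′≤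
              i<i′s = <-≤-trans i<i′ i′≤s
          inner : L j + n′ ≤ L s + d b ps′ j
          inner = subst (λ z → L j + n′ ≤ L z + d b ps′ j) length-ps′ (I.d-gaps-minimal L mono′ strict′ j 1≤j (to-ps′ j≤s))

      blockFacts : BlockFacts ps
      blockFacts = record
        { sum-blocks = sum-blocks ; d-positive = d-positive ; d≤nBlocks = d≤nBlocks ; d-first = d-first
        ; d-last = d-last ; d-monotone = d-monotone ; d-strict = d-strict ; d-gaps-minimal = d-gaps-minimal }

module _ (G : Graph) where
  open Graph G using () renaming (n to N)
  open Walks G

  blockFacts : ∀ {b : Fin N} {ps} → Walk G b ps → BlockFacts b ps
  blockFacts {b} {ps} = go (length ps) ps ≤-refl
    where
      go : ∀ M ps → length ps ≤ M → Walk G b ps → BlockFacts b ps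
      go _       []       _          _ = blockFacts-[] b
      go (suc M) (x ∷ xs) (s≤s |xs|≤M) w =
        ExtendByLastBlock.blockFacts b (x ∷ xs) lb
          (go M (take s (x ∷ xs)) (≤-pred (≤-trans s′<k (s≤s |xs|≤M))) (walk-take s w))
        where
          lb = lastBlock w (s≤s z≤n)
          s = LastBlock.start lb
          s′<k : length (take s (x ∷ xs)) < length (x ∷ xs)
          s′<k = subst (_< length (x ∷ xs)) (sym (length-take-≤ s (x ∷ xs) (<⇒≤ (LastBlock.start<length lb))))
                   (LastBlock.start<length lb)

fin-injective : ∀ {x y} → fin x ≡ fin y → x ≡ y
fin-injective refl = refl

fin≢∞ : ∀ {x} → fin x ≢ ∞
fin≢∞ ()

∞≰fin : ∀ {x} → ¬ (∞ ≤∞ fin x)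
∞≰fin ()

fin≤fin⁻¹ : ∀ {x y} → fin x ≤∞ fin y → x ≤ y
fin≤fin⁻¹ (fin≤fin x≤y) = x≤y

min∞-comm : ∀ x y → min∞ x y ≡ min∞ y x
min∞-comm (fin x) (fin y) = cong fin (⊓-comm x y)
min∞-comm (fin x) ∞       = refl
min∞-comm ∞       (fin y) = refl
min∞-comm ∞       ∞       = refl

min∞≡fin⇒ : ∀ x y {z} → min∞ x y ≡ fin z → x ≡ fin z ⊎ y ≡ fin z
min∞≡fin⇒ (fin x) (fin y) eq with ⊓-sel x y
... | inj₁ x⊓y≡x = inj₁ (cong fin (trans (sym x⊓y≡x) (fin-injective eq)))
... | inj₂ x⊓y≡y = inj₂ (cong fin (trans (sym x⊓y≡y) (fin-injective eq)))
min∞≡fin⇒ (fin x) ∞       eq = inj₁ eq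
min∞≡fin⇒ ∞       y       eq = inj₂ eq

min∞≡fin⇒≤ˡ : ∀ x y {z w} → min∞ x y ≡ fin z → x ≡ fin w → z ≤ w
min∞≡fin⇒≤ˡ (fin x) (fin y) eq refl = subst (_≤ x) (fin-injective eq) (m⊓n≤m x y)
min∞≡fin⇒≤ˡ (fin x) ∞       eq refl = ≤-reflexive (sym (fin-injective eq))

min∞≡∞⇒ : ∀ x y → min∞ x y ≡ ∞ → x ≡ ∞
min∞≡∞⇒ (fin x) (fin y) ()
min∞≡∞⇒ (fin x) ∞       ()
min∞≡∞⇒ ∞       y       _ = refl

truncate : (ℕ → ℕ∞) → ℕ → (ℕ → ℕ∞)
truncate U m i with i <? m
... | yes _ = U i
... | no  _ = ∞

truncate-< : ∀ U {m i} → i < m → truncate U m i ≡ U i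
truncate-< U {m} {i} i<m with i <? m
... | yes _   = refl
... | no  i≮m = ⊥-elim (i≮m i<m)

truncate-≥ : ∀ U {m i} → m ≤ i → truncate U m i ≡ ∞
truncate-≥ U {m} {i} m≤i with i <? m
... | yes i<m = ⊥-elim (<⇒≱ i<m m≤i)
... | no  _   = refl

record LastFinite (U : ℕ → ℕ∞) (M : ℕ) : Set where
  field
    pos        : ℕ
    1≤pos      : 1 ≤ pos
    pos≤M      : pos ≤ M
    value      : ℕ
    at-pos     : U pos ≡ fin value
    beyond-pos : ∀ i → pos < i → i ≤ M → U i ≡ ∞

lastFinite : ∀ U M → (∀ i → 1 ≤ i → i ≤ M → U i ≡ ∞) ⊎ LastFinite U M
lastFinite U zero = inj₁ λ { _ (s≤s _) () }
lastFinite U (suc M) with U (suc M) in eq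
... | fin K = inj₂ record
  { pos = suc M ; 1≤pos = s≤s z≤n ; pos≤M = ≤-refl ; value = K ; at-pos = eq
  ; beyond-pos = λ i M<i i≤M → ⊥-elim (<⇒≱ M<i i≤M) }
... | ∞ with lastFinite U M
...   | inj₁ all∞ = inj₁ λ i 1≤i i≤sM → case-last (m≤n⇒m<n∨m≡n i≤sM) 1≤i
  where
    case-last : ∀ {i} → i < suc M ⊎ i ≡ suc M → 1 ≤ i → U i ≡ ∞
    case-last (inj₁ i<sM) 1≤i = all∞ _ 1≤i (≤-pred i<sM)
    case-last (inj₂ refl) _   = eq
...   | inj₂ lf = inj₂ record
  { pos = pos ; 1≤pos = 1≤pos ; pos≤M = ≤-trans pos≤M (n≤1+n M) ; value = value ; at-pos = at-pos
  ; beyond-pos = λ i pos<i i≤sM → case-last i pos<i (m≤n⇒m<n∨m≡n i≤sM) }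
  where
    open LastFinite lf
    case-last : ∀ i → pos < i → i < suc M ⊎ i ≡ suc M → U i ≡ ∞
    case-last i pos<i (inj₁ i<sM) = beyond-pos i pos<i (≤-pred i<sM)
    case-last i _     (inj₂ refl) = eq

∸1-cancel : ∀ {x y} → 1 ≤ x → 1 ≤ y → x ∸ 1 ≤ y ∸ 1 → x ≤ y
∸1-cancel (s≤s _) (s≤s _) x≤y = s≤s x≤y

∸1-shift : ∀ L a {n D} → 1 ≤ n → 1 ≤ D → L + n ≤ (n + a ∸ 1) + D → L ≤ D + a ∸ 1
∸1-shift L a {suc n} {suc D} _ _ h =
  +-cancelˡ-≤ (suc n) L (D + a) (subst₂ _≤_ (+-comm L (suc n)) (rearrange n a D) h)
  where
    rearrange : ∀ n a D → n + a + suc D ≡ suc n + (D + a)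
    rearrange = solve-∀

module _ (G : Graph) (b : Fin (Graph.n G)) (ℓ : ℕ) where
  open Graph G using () renaming (n to N)
  open Walks G

  label : List (Fin N) → ℕ → ℕ → ℕ
  label ps a r = d b ps r + a ∸ 1

  gτ-inside : ∀ ps a {r} → r ≤ length ps → gτ G b ℓ ps a r ≡ fin (label ps a r)
  gτ-inside ps a {r} r≤k with r ≤ᵇ length ps in eq
  ... | true  = refl
  ... | false = ⊥-elim (<⇒≱ (≤ᵇ≡false⇒> {r} {length ps} eq) r≤k)

  gτ-outside : ∀ ps a {r} → length ps < r → gτ G b ℓ ps a r ≡ ∞
  gτ-outside ps a {r} k<r with r ≤ᵇ length ps in eq
  ... | true  = ⊥-elim (<⇒≱ k<r (≤ᵇ≡true⇒≤ {r} {length ps} eq))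
  ... | false = refl

  IsTableau-take : ∀ {ps L} m → 1 ≤ m → m ≤ length ps → IsTableau G b ℓ ps L → IsTableau G b ℓ (take m ps) L
  IsTableau-take {ps} {L} m 1≤m m≤k (w , mono , strict , bound) = walk-take m w , mono′ , strict′ , bound′
    where
      length-take-m : length (take m ps) ≡ m
      length-take-m = length-take-≤ m ps m≤k
      below-m : ∀ {j} → j ≤ length (take m ps) → j ≤ m
      below-m = subst (_ ≤_) length-take-m
      mono′ : Monotone b (take m ps) L
      mono′ i j 1≤i i≤j j≤ = mono i j 1≤i i≤j (≤-trans (below-m j≤) m≤k)
      strict′ : StrictOnCycles b (take m ps) L
      strict′ i j 1≤i i<j j≤ eq = strict i j 1≤i i<j (≤-trans (below-m j≤) m≤k)
        (trans (sym (vtx-take b ps m (i ∸ 1) (≤-trans (m∸n≤m i 1) (<⇒≤ (<-≤-trans i<j (below-m j≤)))) m≤k))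
               (trans eq (vtx-take b ps m j (below-m j≤) m≤k)))
      bound′ : L (length (take m ps)) + length (take m ps) ≤ ℓ
      bound′ = subst (λ z → L z + z ≤ ℓ) (sym length-take-m)
                 (≤-trans (+-mono-≤ (mono m (length ps) 1≤m m≤k ≤-refl) m≤k) bound)

  module _ {ps} (w : Walk G b ps) where
    private
      module F = BlockFacts (blockFacts G w)
      k = length ps

    nBlocks-positive : 1 ≤ k → 1 ≤ nBlocks b ps
    nBlocks-positive 1≤k = subst (1 ≤_) (F.d-last 1≤k) (F.d-positive k 1≤k ≤-refl)

    label-first : ∀ a → 1 ≤ k → label ps a 1 ≡ a
    label-first a 1≤k = cong (λ x → x + a ∸ 1) (F.d-first 1≤k)

    label-last : ∀ a → 1 ≤ k → label ps a k ≡ nBlocks b ps + a ∸ 1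
    label-last a 1≤k = cong (λ x → x + a ∸ 1) (F.d-last 1≤k)

    label-isTableau : ∀ a → 1 ≤ k → a + k + nBlocks b ps ≤ ℓ + 1 → IsTableau G b ℓ ps (label ps a)
    label-isTableau a 1≤k bound = w , mono , strict , bound′
      where
        mono : Monotone b ps (label ps a)
        mono i j 1≤i i≤j j≤k = ∸-monoˡ-≤ 1 (+-monoˡ-≤ a (F.d-monotone i j 1≤i i≤j j≤k))
        strict : StrictOnCycles b ps (label ps a)
        strict i j 1≤i i<j j≤k eq = ∸-monoˡ-< (+-monoˡ-< a (F.d-strict i j 1≤i i<j j≤k eq))
          (≤-trans (F.d-positive i 1≤i (≤-trans (<⇒≤ i<j) j≤k)) (m≤m+n _ a))
        bound′ : label ps a k + k ≤ ℓ
        bound′ = subst (λ x → x + k ≤ ℓ) (sym (label-last a 1≤k)) (arith a k (nBlocks-positive 1≤k) bound)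
          where
            arith : ∀ a k {n} → 1 ≤ n → a + k + n ≤ ℓ + 1 → n + a ∸ 1 + k ≤ ℓ
            arith a k {suc n} _ h = ≤-pred (subst₂ _≤_ (rearrange a k n) (+-comm ℓ 1) h)
              where
                rearrange : ∀ a k n → a + k + suc n ≡ suc (n + a + k)
                rearrange = solve-∀

    tableau-below-label : ∀ {L} a → IsTableau G b ℓ ps L → 1 ≤ k → L k ≤ label ps a k →
                          ∀ i → 1 ≤ i → i ≤ k → L i ≤ label ps a i
    tableau-below-label {L} a (_ , mono , strict-L , _) 1≤k Lk≤ i 1≤i i≤k =
      ∸1-shift (L i) a (nBlocks-positive 1≤k) (F.d-positive i 1≤i i≤k) (begin
        L i + nBlocks b ps                  ≤⟨ F.d-gaps-minimal L mono strict-L i 1≤i i≤k ⟩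
        L k + d b ps i                      ≤⟨ +-monoˡ-≤ (d b ps i) Lk≤ ⟩
        label ps a k + d b ps i             ≡⟨ cong (_+ d b ps i) (label-last a 1≤k) ⟩
        nBlocks b ps + a ∸ 1 + d b ps i     ∎)
      where open ≤-Reasoning

  module _ (qs : List (Fin N)) where
    private
      ExtTab = IsExtTab G b ℓ qs
      Dom    = InDom G b ℓ qs

    ∞-isExtTab : ExtTab (λ _ → ∞)
    ∞-isExtTab = (λ _ _ _ _ _ → ∞ ≤∞∞) , (λ _ _ _ ())

    truncate-isExtTab : ∀ {U} m → ExtTab U → ExtTab (truncate U m)
    truncate-isExtTab {U} m (mono , prefix) = mono′ , prefix′
      where
        mono′ : ∀ i j → Dom i → Dom j → i ≤ j → truncate U m i ≤∞ truncate U m j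
        mono′ i j di dj i≤j with m ≤? j
        ... | yes m≤j = subst (truncate U m i ≤∞_) (sym (truncate-≥ U m≤j)) (_ ≤∞∞)
        ... | no  m≰j = let j<m = ≰⇒> m≰j in subst₂ _≤∞_ (sym (truncate-< U (≤-<-trans i≤j j<m))) (sym (truncate-< U j<m))
                          (mono i j di dj i≤j)
        prefix′ : ∀ m′ K → Dom m′ → truncate U m m′ ≡ fin K →
                  Σ (ℕ → ℕ) λ L → (∀ i → 1 ≤ i → i ≤ m′ → truncate U m i ≡ fin (L i)) × IsTableau G b ℓ (take m′ qs) L
        prefix′ m′ K dm′ eq with m ≤? m′
        ... | yes m≤m′ = ⊥-elim (fin≢∞ (trans (sym eq) (truncate-≥ U m≤m′)))
        ... | no  m≰m′ =
          let m′<m = ≰⇒> m≰m′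
              L , agree , tab = prefix m′ K dm′ (trans (sym (truncate-< U m′<m)) eq)
          in L , (λ i 1≤i i≤m′ → trans (truncate-< U (≤-<-trans i≤m′ m′<m)) (agree i 1≤i i≤m′)) , tab

    module _ {ps a} (ip : InIPq G b ℓ qs ps a) where
      private
        ps⊑qs = proj₁ ip
        w     = proj₁ (proj₂ ip)
        1≤k   = proj₁ (proj₂ (proj₂ ip))
        bound = proj₂ (proj₂ (proj₂ ip))
        k     = length ps
        U     = gτ G b ℓ ps a

      last-in-dom : Dom k
      last-in-dom = 1≤k , ⊑-length ps⊑qs

      gτ-isExtTab : ExtTab U
      gτ-isExtTab = mono , prefix
        where
          mono : ∀ i j → Dom i → Dom j → i ≤ j → U i ≤∞ U j
          mono i j (1≤i , _) _ i≤j with j ≤? k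
          ... | no  j≰k = subst (U i ≤∞_) (sym (gτ-outside ps a (≰⇒> j≰k))) (U i ≤∞∞)
          ... | yes j≤k = subst₂ _≤∞_ (sym (gτ-inside ps a (≤-trans i≤j j≤k))) (sym (gτ-inside ps a j≤k))
                            (fin≤fin (proj₁ (proj₂ (label-isTableau w a 1≤k bound)) i j 1≤i i≤j j≤k))
          prefix : ∀ m K → Dom m → U m ≡ fin K →
                   Σ (ℕ → ℕ) λ L → (∀ i → 1 ≤ i → i ≤ m → U i ≡ fin (L i)) × IsTableau G b ℓ (take m qs) L
          prefix m K (1≤m , _) eq with m ≤? k
          ... | no  m≰k = ⊥-elim (fin≢∞ (trans (sym eq) (gτ-outside ps a (≰⇒> m≰k))))
          ... | yes m≤k = label ps a , (λ i _ i≤m → gτ-inside ps a (≤-trans i≤m m≤k)) ,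
            subst (λ qs′ → IsTableau G b ℓ qs′ (label ps a)) (sym (⊑⇒take≡take m ps⊑qs m≤k))
              (IsTableau-take m 1≤m m≤k (label-isTableau w a 1≤k bound))

      gτ-notLeast : ¬ (∀ V → ExtTab V → _⪯∞_ G b ℓ qs U V)
      gτ-notLeast least =
        ∞≰fin (subst (∞ ≤∞_) (gτ-inside ps a 1≤k) (least _ ∞-isExtTab 1 (≤-refl , ≤-trans 1≤k (⊑-length ps⊑qs))))

      below-gτ : ∀ {V} → ExtTab V → V k ≡ fin (label ps a k) → ∀ i → 1 ≤ i → i ≤ k → Σ ℕ λ x → V i ≡ fin x × x ≤ label ps a i
      below-gτ (_ , prefix) Vk≡ i 1≤i i≤k =
        let L , agree , tab = prefix k (label ps a k) last-in-dom Vk≡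
            tab′ = subst (λ ps′ → IsTableau G b ℓ ps′ L) (⊑⇒take-length ps⊑qs) tab
            Lk≡ = fin-injective (trans (sym (agree k 1≤k ≤-refl)) Vk≡)
        in L i , agree i 1≤i i≤k , tableau-below-label w a tab′ 1≤k (≤-reflexive Lk≡) i 1≤i i≤k

      agree-at-last⇒≐ : ∀ {V W} → ExtTab V → _≐_ G b ℓ qs U (_∨∞_ G b ℓ qs V W) →
                              V k ≡ fin (label ps a k) → _≐_ G b ℓ qs U V
      agree-at-last⇒≐ {V} {W} extV U≐V∨W Vk≡ i di with i ≤? k
      ... | no  i≰k = trans (gτ-outside ps a (≰⇒> i≰k))
                        (sym (min∞≡∞⇒ (V i) (W i) (trans (sym (U≐V∨W i di)) (gτ-outside ps a (≰⇒> i≰k)))))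
      ... | yes i≤k =
        let x , Vi≡ , x≤ = below-gτ extV Vk≡ i (proj₁ di) i≤k
            ≤x = min∞≡fin⇒≤ˡ (V i) (W i) (trans (sym (U≐V∨W i di)) (gτ-inside ps a i≤k)) Vi≡
        in trans (gτ-inside ps a i≤k) (trans (cong fin (≤-antisym ≤x x≤)) (sym Vi≡))

      gτ-joinIrreducible : JoinIrreducible G b ℓ qs U
      gτ-joinIrreducible = gτ-isExtTab , gτ-notLeast , irreducible
        where
          irreducible : ∀ V W → ExtTab V → ExtTab W → _≐_ G b ℓ qs U (_∨∞_ G b ℓ qs V W) →
                        _≐_ G b ℓ qs U V ⊎ _≐_ G b ℓ qs U W
          irreducible V W extV extW U≐V∨W
            with min∞≡fin⇒ (V k) (W k) (trans (sym (U≐V∨W k last-in-dom)) (gτ-inside ps a ≤-refl))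
          ... | inj₁ Vk≡ = inj₁ (agree-at-last⇒≐ extV U≐V∨W Vk≡)
          ... | inj₂ Wk≡ = inj₂ (agree-at-last⇒≐ extW (λ i di → trans (U≐V∨W i di) (min∞-comm (V i) (W i))) Wk≡)

    gτ-injective : ∀ {ps rs a c} → InIPq G b ℓ qs ps a → InIPq G b ℓ qs rs c →
                   _≐_ G b ℓ qs (gτ G b ℓ ps a) (gτ G b ℓ rs c) → ps ≡ rs × a ≡ c
    gτ-injective {ps} {rs} {a} {c} ipp@(ps⊑ , wp , 1≤kp , _) ipr@(rs⊑ , wr , 1≤kr , _) eq
      with <-cmp (length ps) (length rs)
    ... | tri< kp<kr _ _ = ⊥-elim (fin≢∞ (begin
      fin (label rs c (length rs)) ≡⟨ sym (gτ-inside rs c ≤-refl) ⟩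
      gτ G b ℓ rs c (length rs)    ≡⟨ sym (eq (length rs) (last-in-dom ipr)) ⟩
      gτ G b ℓ ps a (length rs)    ≡⟨ gτ-outside ps a kp<kr ⟩
      ∞                            ∎))
      where open ≡-Reasoning
    ... | tri> _ _ kr<kp = ⊥-elim (fin≢∞ (begin
      fin (label ps a (length ps)) ≡⟨ sym (gτ-inside ps a ≤-refl) ⟩
      gτ G b ℓ ps a (length ps)    ≡⟨ eq (length ps) (last-in-dom ipp) ⟩
      gτ G b ℓ rs c (length ps)    ≡⟨ gτ-outside rs c kr<kp ⟩
      ∞                            ∎))
      where open ≡-Reasoning
    ... | tri≈ _ kp≡kr _ = ⊑-length-injective ps⊑ rs⊑ kp≡kr , (begin
      a                ≡⟨ sym (label-first wp a 1≤kp) ⟩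
      label ps a 1     ≡⟨ fin-injective (trans (sym (gτ-inside ps a 1≤kp)) (trans (eq 1 1∈dom) (gτ-inside rs c 1≤kr))) ⟩
      label rs c 1     ≡⟨ label-first wr c 1≤kr ⟩
      c                ∎)
      where
        open ≡-Reasoning
        1∈dom = ≤-refl , ≤-trans 1≤kp (proj₂ (last-in-dom ipp))

    ⪯IP⇒⪯∞ : ∀ {ps rs a c} → InIPq G b ℓ qs ps a → InIPq G b ℓ qs rs c →
             _⪯IP_ G b ℓ (ps , a) (rs , c) → _⪯∞_ G b ℓ qs (gτ G b ℓ ps a) (gτ G b ℓ rs c)
    ⪯IP⇒⪯∞ {ps} {rs} {a} {c} (_ , wp , 1≤kp , _) (_ , wr , 1≤kr , bound-r) (ps⊑rs , ineq) i (1≤i , _)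
      with i ≤? length ps
    ... | no  i≰kp = subst (gτ G b ℓ rs c i ≤∞_) (sym (gτ-outside ps a (≰⇒> i≰kp))) (_ ≤∞∞)
    ... | yes i≤kp = subst₂ _≤∞_ (sym (gτ-inside rs c (≤-trans i≤kp kp≤kr))) (sym (gτ-inside ps a i≤kp))
                       (fin≤fin (tableau-below-label wp a label-r-on-ps 1≤kp label-r≤ i 1≤i i≤kp))
      where
        kp≤kr = ⊑-length ps⊑rs
        label-r-on-ps : IsTableau G b ℓ ps (label rs c)
        label-r-on-ps = subst (λ ps′ → IsTableau G b ℓ ps′ (label rs c)) (⊑⇒take-length ps⊑rs)
                          (IsTableau-take (length ps) 1≤kp kp≤kr (label-isTableau wr c 1≤kr bound-r))
        label-r≤ : label rs c (length ps) ≤ label ps a (length ps)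
        label-r≤ = subst (label rs c (length ps) ≤_) (sym (label-last wp a 1≤kp)) (∸-monoˡ-≤ 1 ineq)

    ⪯∞⇒⪯IP : ∀ {ps rs a c} → InIPq G b ℓ qs ps a → InIPq G b ℓ qs rs c →
             _⪯∞_ G b ℓ qs (gτ G b ℓ ps a) (gτ G b ℓ rs c) → _⪯IP_ G b ℓ (ps , a) (rs , c)
    ⪯∞⇒⪯IP {ps} {rs} {a} {c} ipp@(ps⊑ , wp , 1≤kp , _) (rs⊑ , wr , _ , _) below
      with length ps ≤? length rs | below (length ps) (last-in-dom ipp)
    ... | no  kp≰kr | at-kp = ⊥-elim (∞≰fin (subst₂ _≤∞_ (gτ-outside rs c (≰⇒> kp≰kr)) (gτ-inside ps a ≤-refl) at-kp))
    ... | yes kp≤kr | at-kp = ⊑-by-length ps⊑ rs⊑ kp≤kr ,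
      ∸1-cancel (≤-trans (BlockFacts.d-positive (blockFacts G wr) (length ps) 1≤kp kp≤kr) (m≤m+n _ c))
                (≤-trans (nBlocks-positive wp 1≤kp) (m≤m+n _ a))
                (subst (label rs c (length ps) ≤_) (label-last wp a 1≤kp)
                  (fin≤fin⁻¹ (subst₂ _≤∞_ (gτ-inside rs c kp≤kr) (gτ-inside ps a ≤-refl) at-kp)))

    module GeneratedByLastFinite {U} (extU : ExtTab U) (lf : LastFinite U (length qs)) where
      open LastFinite lf renaming (pos to m; value to K)

      ps = take m qs
      k  = length ps

      k≡m : k ≡ m
      k≡m = length-take-≤ m qs pos≤M

      restriction : Σ (ℕ → ℕ) λ L → (∀ i → 1 ≤ i → i ≤ m → U i ≡ fin (L i)) × IsTableau G b ℓ ps L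
      restriction = proj₂ extU m K (1≤pos , pos≤M) at-pos

      L   = proj₁ restriction
      tab = proj₂ (proj₂ restriction)
      wp  = proj₁ tab

      U≡L : ∀ i → 1 ≤ i → i ≤ m → U i ≡ fin (L i)
      U≡L = proj₁ (proj₂ restriction)

      1≤k : 1 ≤ k
      1≤k = subst (1 ≤_) (sym k≡m) 1≤pos

      Lk≡K : L k ≡ K
      Lk≡K = fin-injective (trans (sym (U≡L k 1≤k (≤-reflexive k≡m))) (trans (cong U k≡m) at-pos))

      n = nBlocks b ps

      n≤K+1 : n ≤ K + 1
      n≤K+1 = m+n≤o⇒n≤o (L 1) (subst₂ (λ x y → L 1 + n ≤ x + y) Lk≡K (BlockFacts.d-first (blockFacts G wp) 1≤k)
                (BlockFacts.d-gaps-minimal (blockFacts G wp) L (proj₁ (proj₂ tab)) (proj₁ (proj₂ (proj₂ tab))) 1 ≤-refl 1≤k))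

      a = K + 1 ∸ n

      n+a≡K+1 : n + a ≡ K + 1
      n+a≡K+1 = m+[n∸m]≡n n≤K+1

      label-last≡K : label ps a k ≡ K
      label-last≡K = trans (label-last wp a 1≤k) (trans (cong (_∸ 1) n+a≡K+1) (m+n∸n≡m K 1))

      inIPq : InIPq G b ℓ qs ps a
      inIPq = take-⊑ m qs , wp , 1≤k , (begin
        a + k + n       ≡⟨ rearrange a k n ⟩
        (n + a) + k     ≡⟨ cong (_+ k) n+a≡K+1 ⟩
        K + 1 + k       ≡⟨ rearrange K 1 k ⟩
        (k + K) + 1     ≡⟨ cong (_+ 1) (+-comm k K) ⟩
        (K + k) + 1     ≤⟨ +-monoˡ-≤ 1 (subst (λ x → x + k ≤ ℓ) Lk≡K (proj₂ (proj₂ (proj₂ tab)))) ⟩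
        ℓ + 1           ∎)
        where
          open ≤-Reasoning
          rearrange : ∀ x y z → x + y + z ≡ z + x + y
          rearrange = solve-∀

      U≐gτ∨truncate : _≐_ G b ℓ qs U (_∨∞_ G b ℓ qs (gτ G b ℓ ps a) (truncate U m))
      U≐gτ∨truncate i (1≤i , i≤) with <-cmp i m
      ... | tri< i<m _ _ = begin
        U i                                       ≡⟨ U≡L i 1≤i (<⇒≤ i<m) ⟩
        fin (L i)                                 ≡⟨ cong fin (sym (m≥n⇒m⊓n≡n L≤label)) ⟩
        min∞ (fin (label ps a i)) (fin (L i))     ≡⟨ cong₂ min∞ (sym (gτ-inside ps a i≤k))
                                                              (sym (trans (truncate-< U i<m) (U≡L i 1≤i (<⇒≤ i<m)))) ⟩
        min∞ (gτ G b ℓ ps a i) (truncate U m i)   ∎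
        where
          open ≡-Reasoning
          i≤k = subst (i ≤_) (sym k≡m) (<⇒≤ i<m)
          L≤label = tableau-below-label wp a tab 1≤k (≤-reflexive (trans Lk≡K (sym label-last≡K))) i 1≤i i≤k
      ... | tri≈ _ refl _ = begin
        U m                                       ≡⟨ at-pos ⟩
        fin K                                     ≡⟨ cong fin (sym label-last≡K) ⟩
        fin (label ps a k)                        ≡⟨ cong₂ min∞ (sym (trans (cong (gτ G b ℓ ps a) (sym k≡m)) (gτ-inside ps a ≤-refl)))
                                                                (sym (truncate-≥ U {m} ≤-refl)) ⟩
        min∞ (gτ G b ℓ ps a m) (truncate U m m)   ∎
        where open ≡-Reasoning
      ... | tri> _ _ m<i = begin
        U i                                       ≡⟨ beyond-pos i m<i i≤ ⟩
        ∞                                         ≡⟨ cong₂ min∞ (sym (gτ-outside ps a (subst (_< i) (sym k≡m) m<i)))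
                                                                (sym (truncate-≥ U (<⇒≤ m<i))) ⟩
        min∞ (gτ G b ℓ ps a i) (truncate U m i)   ∎
        where open ≡-Reasoning

      generated : JoinIrreducible G b ℓ qs U → _≐_ G b ℓ qs (gτ G b ℓ ps a) U
      generated (_ , _ , irreducible)
        with irreducible _ _ (gτ-isExtTab inIPq) (truncate-isExtTab m extU) U≐gτ∨truncate
      ... | inj₁ U≐gτ = λ i di → sym (U≐gτ i di)
      ... | inj₂ U≐truncate =
        ⊥-elim (fin≢∞ (trans (sym at-pos) (trans (U≐truncate m (1≤pos , pos≤M)) (truncate-≥ U {m} ≤-refl))))

    joinIrreducible⇒gτ : ∀ {U} → JoinIrreducible G b ℓ qs U →
                         Σ (List (Fin N)) λ ps → Σ ℕ λ a → InIPq G b ℓ qs ps a × _≐_ G b ℓ qs (gτ G b ℓ ps a) U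
    joinIrreducible⇒gτ {U} ji@(extU , notLeast , _) with lastFinite U (length qs)
    ... | inj₁ all∞ = ⊥-elim (notLeast λ V _ i (1≤i , i≤) → subst (V i ≤∞_) (sym (all∞ i 1≤i i≤)) (V i ≤∞∞))
    ... | inj₂ lf   = ps , a , inIPq , generated ji
      where open GeneratedByLastFinite extU lf

lemma3p8 : (G : Graph) → Connected G → (b : Fin (Graph.n G)) → (ℓ : ℕ)
    → (qs : List (Fin (Graph.n G))) → Walk G b qs
    → ((ps : List (Fin (Graph.n G))) (a : ℕ) → InIPq G b ℓ qs ps a
         → JoinIrreducible G b ℓ qs (gτ G b ℓ ps a))
    × ((ps rs : List (Fin (Graph.n G))) (a c : ℕ) → InIPq G b ℓ qs ps a → InIPq G b ℓ qs rs c
         → _≐_ G b ℓ qs (gτ G b ℓ ps a) (gτ G b ℓ rs c) → (ps ≡ rs) × (a ≡ c))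
    × ((U : ℕ → ℕ∞) → JoinIrreducible G b ℓ qs U
         → Σ (List (Fin (Graph.n G))) λ ps → Σ ℕ λ a → InIPq G b ℓ qs ps a
             × _≐_ G b ℓ qs (gτ G b ℓ ps a) U)
    × ((ps rs : List (Fin (Graph.n G))) (a c : ℕ) → InIPq G b ℓ qs ps a → InIPq G b ℓ qs rs c
         → (_⪯IP_ G b ℓ (ps , a) (rs , c) → _⪯∞_ G b ℓ qs (gτ G b ℓ ps a) (gτ G b ℓ rs c))
         × (_⪯∞_ G b ℓ qs (gτ G b ℓ ps a) (gτ G b ℓ rs c) → _⪯IP_ G b ℓ (ps , a) (rs , c)))
lemma3p8 G _ b ℓ qs _ =
    (λ _ _ ip → gτ-joinIrreducible G b ℓ qs ip)
  , (λ _ _ _ _ ipp ipr → gτ-injective G b ℓ qs ipp ipr)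
  , (λ _ ji → joinIrreducible⇒gτ G b ℓ qs ji)
  , (λ _ _ _ _ ipp ipr → ⪯IP⇒⪯∞ G b ℓ qs ipp ipr , ⪯∞⇒⪯IP G b ℓ qs ipp ipr)
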